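{- Let $\mathcal H=\{P_4, C_4\}$. Then for every integer $n\ge 4$, $\chi'_{\mathcal H}(n) = \lceil n/2\rceil+1$.
   Context: For a graph $G$ and a set $\mathcal H$ of small graphs, an $\mathcal H$-avoiding bipartite partition of $G$ is a collection of bipartite graphs $G_1,\dots,G_k$ (subgraphs of $G$, each without isolated vertices and nonempty) whose edge sets are pairwise disjoint with union $E(G)$, such that no $G_i$ contains any member of $\mathcal H$ as an induced subgraph. $\chi'_{\mathcal H}(G)$ is the smallest $k$ for which such a partition with $k$ graphs exists, and $\chi'_{\mathcal H}(n):=\chi'_{\mathcal H}(K_n)$, where $K_n$ is the complete graph on $n$ vertices. $P_4$ is the path on 4 vertices and $C_4$ the cycle on 4 vertices. -}

module Defs where

open import Data.Nat using (ℕ; _≤_)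
open import Data.Fin using (Fin)
open import Data.Bool using (Bool)
open import Data.Product using (Σ; ∃; ∃-syntax; _×_)
open import Relation.Nullary using (¬_)
open import Relation.Binary.PropositionalEquality using (_≡_; _≢_)

Graph : ℕ → Set₁
Graph n = Fin n → Fin n → Set

IsBipartite : {n : ℕ} → Graph n → Set
IsBipartite {n} G = Σ (Fin n → Bool) λ f → ∀ x y → G x y → f x ≢ f y

Distinct4 : {n : ℕ} → Fin n → Fin n → Fin n → Fin n → Set
Distinct4 a b c d =
  a ≢ b × a ≢ c × a ≢ d × b ≢ c × b ≢ d × c ≢ d

HasInducedP4 : {n : ℕ} → Graph n → Set
HasInducedP4 {n} G = ∃[ a ] ∃[ b ] ∃[ c ] ∃[ d ]
  (Distinct4 {n} a b c d × G a b × G b c × G c d × ¬ G a c × ¬ G b d × ¬ G a d)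

HasInducedC4 : {n : ℕ} → Graph n → Set
HasInducedC4 {n} G = ∃[ a ] ∃[ b ] ∃[ c ] ∃[ d ]
  (Distinct4 {n} a b c d × G a b × G b c × G c d × G d a × ¬ G a c × ¬ G b d)

-- An edge colouring of K_n with colours Fin k: a symmetric function
-- (its values on the diagonal are irrelevant).  Colour class i is the
-- subgraph G_i of K_n whose edges are the edges of colour i (and whose
-- vertices are their endpoints, so G_i has no isolated vertices).
ColourClass : {n k : ℕ} → (Fin n → Fin n → Fin k) → Fin k → Graph n
ColourClass c i x y = (x ≢ y) × (c x y ≡ i)

record P4C4AvoidingBipartitePartition (n k : ℕ) : Set where
  field
    colour    : Fin n → Fin n → Fin k
    symmetric : ∀ x y → colour x y ≡ colour y x
    nonempty  : ∀ i → ∃[ x ] ∃[ y ] (x ≢ y × colour x y ≡ i)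
    bipartite : ∀ i → IsBipartite (ColourClass colour i)
    P4-free   : ∀ i → ¬ HasInducedP4 (ColourClass colour i)
    C4-free   : ∀ i → ¬ HasInducedC4 (ColourClass colour i)

ChiP4C4Is : ℕ → ℕ → Set
ChiP4C4Is n m =
  P4C4AvoidingBipartitePartition n m ×
  (∀ k → P4C4AvoidingBipartitePartition n k → m ≤ k)

{-# OPTIONS --safe #-}
module Submission where

-- A bipartite graph without induced P4 or C4 is triangle-free and contains no path on four vertices at
-- all, i.e. it is a star forest; conversely every star forest qualifies.  So we are computing the star
-- arboricity of K_n.
--
-- Upper bound: read vertex x as the pair (⌊x/2⌋, x mod 2).  The pairs {(h,0),(h,1)} form a matching, and for
-- every t < ⌈n/2⌉ the two vertices (t,s) are centres of stars joining (t,s) to (h,s) for h > t and to (h,1-s)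
-- for h < t.  These ⌈n/2⌉ + 1 star forests partition E(K_n).
--
-- Lower bound: given k star forests, orient every edge from the centre of its monochromatic star to the leaf.
-- A vertex then has at most one in-arc per colour; call the colours in which v has none its root colours.
-- Counting arcs gives Σ_v roots(v) = nk - n(n-1)/2.  If k ≤ ⌈n/2⌉, then k + 2 ≤ n, so every vertex has a root
-- colour (otherwise its n-1 edges would have distinct colours), and two vertices with a single root colour
-- have different ones, so Σ_v roots(v) ≥ 2n - k.  Together: n(n+3) ≤ 2k(n+1) ≤ (n+1)², impossible for n ≥ 2.

open import Defs
open import Data.Nat using (ℕ; zero; suc; _+_; _*_; _≤_; _<_; z≤n; s≤s; ⌈_/2⌉; ⌊_/2⌋)
open import Data.Nat.Properties
open import Data.Nat.Tactic.RingSolver using (solve)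
open import Algebra.Properties.CommutativeMonoid.Sum +-0-commutativeMonoid
  using (sum; sum-syntax; ∑-comm; ∑-distrib-+; sum-cong-≗)
open import Data.Bool using (Bool; true; false; not)
open import Data.Bool.Properties using (¬-not; not-¬; not-injective; not-involutive) renaming (_≟_ to _≟ᵇ_)
open import Data.Empty using (⊥)
open import Data.Fin using (Fin; zero; suc) renaming (_<_ to _<ᶠ_)
import Data.Fin.Properties as Finₚ
open Finₚ using (any?) renaming (_≟_ to _≟ᶠ_; _<?_ to _<ᶠ?_)
open import Data.List using (_∷_; [])
open import Data.Product using (∃-syntax; _×_; _,_; proj₁; proj₂)
open import Data.Sum using (_⊎_; inj₁; inj₂; [_,_]′)
open import Function using (_∘_)
open import Relation.Binary.Definitions using (Symmetric; tri<; tri≈; tri>)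
open import Relation.Binary.PropositionalEquality
open import Relation.Nullary using (¬_; Dec; yes; no; does; ¬?; _×-dec_; _⊎-dec_)
open import Relation.Nullary.Negation using (contradiction)
open import Relation.Nullary.Decidable using (decidable-stable; ¬¬-excluded-middle; dec-true; dec-false)

TriangleFree : {n : ℕ} → Graph n → Set
TriangleFree G = ∀ {a b c} → G a b → G b c → G a c → ⊥

HasP4 : {n : ℕ} → Graph n → Set
HasP4 {n} G = ∃[ a ] ∃[ b ] ∃[ c ] ∃[ d ] (Distinct4 {n} a b c d × G a b × G b c × G c d)

inducedP4⇒P4 : ∀ {n} {G : Graph n} → HasInducedP4 G → HasP4 G
inducedP4⇒P4 (a , b , c , d , δ , ab , bc , cd , _) = a , b , c , d , δ , ab , bc , cd

inducedC4⇒P4 : ∀ {n} {G : Graph n} → HasInducedC4 G → HasP4 G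
inducedC4⇒P4 (a , b , c , d , δ , ab , bc , cd , _) = a , b , c , d , δ , ab , bc , cd

bipartite⇒triangleFree : ∀ {n} {G : Graph n} → IsBipartite G → TriangleFree G
bipartite⇒triangleFree (_ , proper) {a} {b} {c} ab bc ac =
  proper a c ac (trans (¬-not (proper a b ab)) (trans (cong not (¬-not (proper b c bc))) (not-involutive _)))

-- A P4 without chords is induced; a chord ac or bd would close a triangle, and the chord ad closes a C4.
¬inducedP4∧¬inducedC4⇒¬P4 : ∀ {n} {G : Graph n} → Symmetric G → TriangleFree G →
                            ¬ HasInducedP4 G → ¬ HasInducedC4 G → ¬ HasP4 G
¬inducedP4∧¬inducedC4⇒¬P4 {G = G} sym-G noΔ noP4 noC4 (a , b , c , d , δ , ab , bc , cd) =
  ¬¬-excluded-middle λ where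
    (yes da) → noC4 (a , b , c , d , δ , ab , bc , cd , da , ¬ac , ¬bd)
    (no ¬da) → noP4 (a , b , c , d , δ , ab , bc , cd , ¬ac , ¬bd , ¬da ∘ sym-G)
  where
  ¬ac : ¬ G a c
  ¬ac = noΔ ab bc
  ¬bd : ¬ G b d
  ¬bd = noΔ bc cd

record StarForest {n : ℕ} (G : Graph n) : Set where
  field
    isCentre              : Fin n → Bool
    proper                : ∀ {x y} → G x y → isCentre x ≢ isCentre y
    leaf-neighbour-unique : ∀ {x y z} → isCentre x ≡ false → G x y → G x z → y ≡ z

module _ {n : ℕ} {G : Graph n} (F : StarForest G) where
  open StarForest F

  starForest⇒bipartite : IsBipartite G
  starForest⇒bipartite = isCentre , λ _ _ → proper

  starForest⇒¬P4 : Symmetric G → ¬ HasP4 G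
  starForest⇒¬P4 sym-G (a , b , c , d , (_ , a≢c , _ , _ , b≢d , _) , ab , bc , cd)
    with isCentre b in eq
  ... | false = a≢c (leaf-neighbour-unique eq (sym-G ab) bc)
  ... | true  = b≢d (leaf-neighbour-unique (trans (¬-not (proper (sym-G bc))) (cong not eq)) (sym-G bc) cd)

∑-const : ∀ n c → ∑[ i < n ] c ≡ n * c
∑-const zero    c = refl
∑-const (suc n) c = cong (c +_) (∑-const n c)

∑1≡n : ∀ n → ∑[ i < n ] 1 ≡ n
∑1≡n n = trans (∑-const n 1) (*-identityʳ n)

∑-mono-≤ : ∀ {n} {f g : Fin n → ℕ} → (∀ i → f i ≤ g i) → sum f ≤ sum g
∑-mono-≤ {zero}  f≤g = z≤n
∑-mono-≤ {suc n} f≤g = +-mono-≤ (f≤g zero) (∑-mono-≤ (f≤g ∘ suc))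

∑-point : ∀ {n} (f : Fin n → ℕ) i → f i ≤ sum f
∑-point f zero    = m≤m+n _ _
∑-point f (suc i) = ≤-trans (∑-point (f ∘ suc) i) (m≤n+m _ _)

∑-pair : ∀ {n} (f : Fin n → ℕ) {i j} → i ≢ j → f i + f j ≤ sum f
∑-pair f {zero}  {zero}  i≢j = contradiction refl i≢j
∑-pair f {zero}  {suc j} _   = +-monoʳ-≤ (f zero) (∑-point (f ∘ suc) j)
∑-pair f {suc i} {zero}  _   =
  ≤-trans (≤-reflexive (+-comm (f (suc i)) (f zero))) (+-monoʳ-≤ (f zero) (∑-point (f ∘ suc) i))
∑-pair f {suc i} {suc j} i≢j = ≤-trans (∑-pair (f ∘ suc) (i≢j ∘ cong suc)) (m≤n+m _ _)

indicator : {P : Set} → Dec P → ℕ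
indicator (yes _) = 1
indicator (no _)  = 0

indicator-yes : {P : Set} → P → (P? : Dec P) → indicator P? ≡ 1
indicator-yes p (yes _) = refl
indicator-yes p (no ¬p) = contradiction p ¬p

indicator-no : {P : Set} → ¬ P → (P? : Dec P) → indicator P? ≡ 0
indicator-no ¬p (yes p) = contradiction p ¬p
indicator-no ¬p (no _)  = refl

indicator-cong : {P Q : Set} → (P → Q) → (Q → P) → (P? : Dec P) (Q? : Dec Q) → indicator P? ≡ indicator Q?
indicator-cong P⇒Q Q⇒P (yes p) Q? = sym (indicator-yes (P⇒Q p) Q?)
indicator-cong P⇒Q Q⇒P (no ¬p) Q? = sym (indicator-no (¬p ∘ Q⇒P) Q?)

indicator-¬ : {P : Set} (P? : Dec P) → indicator P? + indicator (¬? P?) ≡ 1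
indicator-¬ (yes _) = refl
indicator-¬ (no _)  = refl

2≤m+[m≡1] : ∀ {m} → 1 ≤ m → (m≡1? : Dec (m ≡ 1)) → 2 ≤ m + indicator m≡1?
2≤m+[m≡1] {suc zero}    _ m≡1? = ≤-reflexive (cong suc (sym (indicator-yes refl m≡1?)))
2≤m+[m≡1] {suc (suc m)} _ _    = s≤s (s≤s z≤n)

count : ∀ {n} {P : Fin n → Set} → (∀ x → Dec (P x)) → ℕ
count {n} P? = ∑[ x < n ] indicator (P? x)

module _ {n : ℕ} {P : Fin n → Set} where

  count-cong : {Q : Fin n → Set} → (∀ {x} → P x → Q x) → (∀ {x} → Q x → P x) →
               (P? : ∀ x → Dec (P x)) (Q? : ∀ x → Dec (Q x)) → count P? ≡ count Q?
  count-cong P⇒Q Q⇒P P? Q? = sum-cong-≗ λ x → indicator-cong P⇒Q Q⇒P (P? x) (Q? x)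

  count-complement : (P? : ∀ x → Dec (P x)) → count P? + count (¬? ∘ P?) ≡ n
  count-complement P? = begin
    count P? + count (¬? ∘ P?)                             ≡⟨ ∑-distrib-+ (indicator ∘ P?) (indicator ∘ ¬? ∘ P?) ⟨
    ∑[ x < n ] (indicator (P? x) + indicator (¬? (P? x)))  ≡⟨ sum-cong-≗ (indicator-¬ ∘ P?) ⟩
    ∑[ x < n ] 1                                           ≡⟨ ∑1≡n n ⟩
    n                                                      ∎
    where open ≡-Reasoning

  count-none : (P? : ∀ x → Dec (P x)) → (∀ x → ¬ P x) → count P? ≡ 0
  count-none P? none = trans (sum-cong-≗ λ x → indicator-no (none x) (P? x)) (trans (∑-const n 0) (*-zeroʳ n))

  count-positive : (P? : ∀ x → Dec (P x)) → ∀ {x} → P x → 1 ≤ count P?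
  count-positive P? {x} px = ≤-trans (≤-reflexive (sym (indicator-yes px (P? x)))) (∑-point (indicator ∘ P?) x)

  count-pair : (P? : ∀ x → Dec (P x)) → ∀ {x y} → x ≢ y → P x → P y → 2 ≤ count P?
  count-pair P? {x} {y} x≢y px py = begin
    2                                         ≡⟨ cong₂ _+_ (indicator-yes px (P? x)) (indicator-yes py (P? y)) ⟨
    indicator (P? x) + indicator (P? y)       ≤⟨ ∑-pair (indicator ∘ P?) x≢y ⟩
    count P?                                  ∎
    where open ≤-Reasoning

count-≤1 : ∀ {n} {P : Fin n → Set} (P? : ∀ x → Dec (P x)) → (∀ {x y} → P x → P y → x ≡ y) → count P? ≤ 1
count-≤1 {zero}  P? unique = z≤n
count-≤1 {suc n} P? unique with P? zero
... | yes p₀ = ≤-reflexive (cong suc (count-none (P? ∘ suc) λ x px → Finₚ.0≢1+n (unique p₀ px)))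
... | no _   = count-≤1 (P? ∘ suc) λ px py → Finₚ.suc-injective (unique px py)

count-unique : ∀ {n} {P : Fin n → Set} (P? : ∀ x → Dec (P x)) → (∀ {x y} → P x → P y → x ≡ y) →
               count P? ≡ indicator (any? P?)
count-unique P? unique with any? P?
... | yes (x , px) = ≤-antisym (count-≤1 P? unique) (count-positive P? px)
... | no ∄x        = count-none P? λ x px → ∄x (x , px)

count-≡ : ∀ {n} (v : Fin n) → count (_≟ᶠ v) ≡ 1
count-≡ v = trans (count-unique (_≟ᶠ v) λ p q → trans p (sym q)) (indicator-yes (v , refl) (any? (_≟ᶠ v)))

module _ {m n : ℕ} {R : Fin m → Fin n → Set} (R? : ∀ x y → Dec (R x y)) where

  indicator-any≤count : ∀ x → indicator (any? (R? x)) ≤ count (R? x)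
  indicator-any≤count x with any? (R? x)
  ... | yes (y , r) = count-positive (R? x) r
  ... | no _        = z≤n

  count-domain≤ : (∀ {x x′ y} → R x y → R x′ y → x ≡ x′) → count (λ x → any? (R? x)) ≤ n
  count-domain≤ injective = begin
    count (λ x → any? (R? x))             ≤⟨ ∑-mono-≤ indicator-any≤count ⟩
    ∑[ x < m ] count (R? x)               ≡⟨ ∑-comm (λ x y → indicator (R? x y)) ⟩
    ∑[ y < n ] count (λ x → R? x y)       ≤⟨ ∑-mono-≤ (λ y → count-≤1 (λ x → R? x y) injective) ⟩
    ∑[ y < n ] 1                          ≡⟨ ∑1≡n n ⟩
    n                                     ∎
    where open ≤-Reasoning

  count-domain≡count-range : (∀ {x y y′} → R x y → R x y′ → y ≡ y′) →
                             (∀ {x x′ y} → R x y → R x′ y → x ≡ x′) →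
                             count (λ x → any? (R? x)) ≡ count (λ y → any? (λ x → R? x y))
  count-domain≡count-range functional injective = begin
    count (λ x → any? (R? x))               ≡⟨ sum-cong-≗ (λ x → count-unique (R? x) functional) ⟨
    ∑[ x < m ] count (R? x)                 ≡⟨ ∑-comm (λ x y → indicator (R? x y)) ⟩
    ∑[ y < n ] count (λ x → R? x y)         ≡⟨ sum-cong-≗ (λ y → count-unique (λ x → R? x y) injective) ⟩
    count (λ y → any? (λ x → R? x y))       ∎
    where open ≡-Reasoning

module _ {n : ℕ} {T : Fin n → Fin n → Set} (T? : ∀ u v → Dec (T u v))
         (irreflexive : ∀ {u} → ¬ T u u) (asymmetric : ∀ {u v} → T u v → ¬ T v u)
         (total : ∀ {u v} → u ≢ v → T u v ⊎ T v u) where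

  private
    pair : ∀ u v → indicator (T? u v) + indicator (T? v u) + indicator (u ≟ᶠ v) ≡ 1
    pair u v with u ≟ᶠ v
    ... | yes refl = cong₂ (λ a b → a + b + 1) (indicator-no irreflexive (T? u u)) (indicator-no irreflexive (T? u u))
    ... | no u≢v with total u≢v
    ...   | inj₁ uv = cong₂ (λ a b → a + b + 0) (indicator-yes uv (T? u v)) (indicator-no (asymmetric uv) (T? v u))
    ...   | inj₂ vu = cong₂ (λ a b → a + b + 0) (indicator-no (asymmetric vu) (T? u v)) (indicator-yes vu (T? v u))

  tournament-arcs : 2 * ∑[ v < n ] count (λ u → T? u v) + n ≡ n * n
  tournament-arcs = begin
    2 * A + n                                        ≡⟨ cong (λ x → A + x + n) (+-identityʳ A) ⟩
    A + A + n                                        ≡⟨ cong (λ x → A + x + n) (∑-comm {n} {n} (λ v u → indicator (T? v u))) ⟨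
    A + ∑[ v < n ] outdeg v + n                      ≡⟨ cong₂ _+_ (∑-distrib-+ indeg outdeg) (∑1≡n n) ⟨
    ∑[ v < n ] (indeg v + outdeg v) + ∑[ v < n ] 1   ≡⟨ ∑-distrib-+ (λ v → indeg v + outdeg v) (λ _ → 1) ⟨
    ∑[ v < n ] (indeg v + outdeg v + 1)              ≡⟨ sum-cong-≗ degree ⟩
    ∑[ v < n ] n                                     ≡⟨ ∑-const n n ⟩
    n * n                                            ∎
    where
    open ≡-Reasoning
    indeg outdeg : Fin n → ℕ
    indeg v  = count (λ u → T? u v)
    outdeg v = count (T? v)
    A : ℕ
    A = ∑[ v < n ] indeg v
    degree : ∀ v → indeg v + outdeg v + 1 ≡ n
    degree v = begin
      indeg v + outdeg v + 1
        ≡⟨ cong (indeg v + outdeg v +_) (count-≡ v) ⟨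
      indeg v + outdeg v + count (_≟ᶠ v)
        ≡⟨ cong (_+ count (_≟ᶠ v)) (∑-distrib-+ (λ u → indicator (T? u v)) (λ u → indicator (T? v u))) ⟨
      ∑[ u < n ] (indicator (T? u v) + indicator (T? v u)) + count (_≟ᶠ v)
        ≡⟨ ∑-distrib-+ (λ u → indicator (T? u v) + indicator (T? v u)) (λ u → indicator (u ≟ᶠ v)) ⟨
      ∑[ u < n ] (indicator (T? u v) + indicator (T? v u) + indicator (u ≟ᶠ v))
        ≡⟨ sum-cong-≗ (λ u → pair u v) ⟩
      ∑[ u < n ] 1
        ≡⟨ ∑1≡n n ⟩
      n ∎

colourClass-symmetric : ∀ {n k} {c : Fin n → Fin n → Fin k} → (∀ x y → c x y ≡ c y x) →
                        ∀ i → Symmetric (ColourClass c i)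
colourClass-symmetric c-sym i {x} {y} (x≢y , xy) = x≢y ∘ sym , trans (c-sym y x) xy

record StarForestColouring (n k : ℕ) : Set where
  field
    colour        : Fin n → Fin n → Fin k
    symmetric     : ∀ x y → colour x y ≡ colour y x
    triangle-free : ∀ i → TriangleFree (ColourClass colour i)
    P4-free       : ∀ i → ¬ HasP4 (ColourClass colour i)

partition⇒starForestColouring : ∀ {n k} → P4C4AvoidingBipartitePartition n k → StarForestColouring n k
partition⇒starForestColouring P = record
  { colour        = colour
  ; symmetric     = symmetric
  ; triangle-free = triangle-free
  ; P4-free       = λ i → ¬inducedP4∧¬inducedC4⇒¬P4 (colourClass-symmetric symmetric i) (triangle-free i)
                                                  (P4-free i) (C4-free i)
  }
  where
  open P4C4AvoidingBipartitePartition P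
  triangle-free : ∀ i → TriangleFree (ColourClass colour i)
  triangle-free i = bipartite⇒triangleFree (bipartite i)

counting-arithmetic : ∀ {n k P R U} → P + R ≡ n * k → 2 * P + n ≡ n * n → 2 * n ≤ R + U → U ≤ k →
                      n * (n + 3) ≤ (n + 1) * (2 * k)
counting-arithmetic {n} {k} {P} {R} {U} P+R≡nk 2P+n≡n² 2n≤R+U U≤k = +-cancelʳ-≤ n _ _ (begin
  n * (n + 3) + n                  ≡⟨ solve (n ∷ []) ⟩
  n * n + 2 * (2 * n)              ≡⟨ cong (_+ 2 * (2 * n)) 2P+n≡n² ⟨
  2 * P + n + 2 * (2 * n)          ≤⟨ +-monoʳ-≤ (2 * P + n) (*-monoʳ-≤ 2 2n≤R+U) ⟩
  2 * P + n + 2 * (R + U)          ≡⟨ solve (P ∷ R ∷ U ∷ n ∷ []) ⟩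
  2 * (P + R) + 2 * U + n          ≡⟨ cong (λ x → 2 * x + 2 * U + n) P+R≡nk ⟩
  2 * (n * k) + 2 * U + n          ≤⟨ +-monoˡ-≤ n (+-monoʳ-≤ (2 * (n * k)) (*-monoʳ-≤ 2 U≤k)) ⟩
  2 * (n * k) + 2 * k + n          ≡⟨ solve (n ∷ k ∷ []) ⟩
  (n + 1) * (2 * k) + n            ∎)
  where open ≤-Reasoning

-- Hub u v: u has a second edge of the colour of uv, so u is the centre of the star containing uv.  Parent
-- orients each edge from the centre of its star to the leaf, single-edge stars from the smaller endpoint.
module Orientation {n k : ℕ} (C : StarForestColouring n k) where
  open StarForestColouring C renaming (colour to c)

  Hub : Fin n → Fin n → Set
  Hub u v = ∃[ w ] (w ≢ v × ColourClass c (c u v) u w)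

  hub? : ∀ u v → Dec (Hub u v)
  hub? u v = any? λ w → ¬? (w ≟ᶠ v) ×-dec ¬? (u ≟ᶠ w) ×-dec (c u w ≟ᶠ c u v)

  ¬hub-both : ∀ {u v} → u ≢ v → Hub u v → Hub v u → ⊥
  ¬hub-both {u} {v} u≢v (w , w≢v , u≢w , uw) (x , x≢u , v≢x , vx) with w ≟ᶠ x
  ... | yes refl = triangle-free (c u v) (u≢v , refl) (v≢x , trans vx (symmetric v u)) (u≢w , uw)
  ... | no w≢x   = P4-free (c u v) (w , u , v , x , (u≢w ∘ sym , w≢v , w≢x , u≢v , x≢u ∘ sym , v≢x)
                                   , colourClass-symmetric symmetric _ (u≢w , uw) , (u≢v , refl) , (v≢x , trans vx (symmetric v u)))

  Parent : Fin n → Fin n → Set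
  Parent u v = u ≢ v × (Hub u v ⊎ (¬ Hub v u × u <ᶠ v))

  parent? : ∀ u v → Dec (Parent u v)
  parent? u v = ¬? (u ≟ᶠ v) ×-dec (hub? u v ⊎-dec (¬? (hub? v u) ×-dec (u <ᶠ? v)))

  parent⇒¬hub : ∀ {u v} → Parent u v → ¬ Hub v u
  parent⇒¬hub (u≢v , inj₁ hub)       = ¬hub-both u≢v hub
  parent⇒¬hub (_   , inj₂ (¬hub , _)) = ¬hub

  parent-asym : ∀ {u v} → Parent u v → ¬ Parent v u
  parent-asym uv                   (_ , inj₁ hub)        = parent⇒¬hub uv hub
  parent-asym (_ , inj₁ hub)       (_ , inj₂ (¬hub , _)) = ¬hub hub
  parent-asym (_ , inj₂ (_ , u<v)) (_ , inj₂ (_ , v<u))  = Finₚ.<-asym u<v v<u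

  parent-total : ∀ {u v} → u ≢ v → Parent u v ⊎ Parent v u
  parent-total {u} {v} u≢v with hub? u v | hub? v u
  ... | yes huv | _       = inj₁ (u≢v , inj₁ huv)
  ... | no _    | yes hvu = inj₂ (u≢v ∘ sym , inj₁ hvu)
  ... | no ¬huv | no ¬hvu with Finₚ.<-cmp u v
  ...   | tri< u<v _ _ = inj₁ (u≢v , inj₂ (¬hvu , u<v))
  ...   | tri≈ _ u≡v _ = contradiction u≡v u≢v
  ...   | tri> _ _ v<u = inj₂ (u≢v ∘ sym , inj₂ (¬huv , v<u))

  sole-edge-to-parent : ∀ {u v w} → Parent u v → w ≢ v → c v w ≡ c u v → w ≡ u
  sole-edge-to-parent {u} {v} {w} uv w≢v vw≡uv =
    decidable-stable (w ≟ᶠ u) λ w≢u → parent⇒¬hub uv (w , w≢u , w≢v ∘ sym , trans vw≡uv (symmetric u v))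

  parent-unique : ∀ {u u′ v} → Parent u v → Parent u′ v → c u v ≡ c u′ v → u ≡ u′
  parent-unique {u} {u′} {v} uv (u′≢v , _) same = sym (sole-edge-to-parent uv u′≢v (trans (symmetric v u′) (sym same)))

  HasParent : Fin n → Fin k → Set
  HasParent v i = ∃[ u ] (Parent u v × c u v ≡ i)

  hasParent? : ∀ v i → Dec (HasParent v i)
  hasParent? v i = any? λ u → parent? u v ×-dec (c u v ≟ᶠ i)

  parents : Fin n → ℕ
  parents v = count (λ u → parent? u v)

  roots : Fin n → ℕ
  roots v = count (λ i → ¬? (hasParent? v i))

  parents+roots≡k : ∀ v → parents v + roots v ≡ k
  parents+roots≡k v = trans (cong (_+ roots v) parents≡count-hasParent) (count-complement (hasParent? v))
    where
    R? : ∀ u i → Dec (Parent u v × c u v ≡ i)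
    R? u i = parent? u v ×-dec (c u v ≟ᶠ i)
    parents≡count-hasParent : parents v ≡ count (hasParent? v)
    parents≡count-hasParent =
      trans (count-cong (λ {u} p → c u v , p , refl) (λ (_ , p , _) → p) (λ u → parent? u v) (λ u → any? (R? u)))
            (count-domain≡count-range R? (λ (_ , ui) (_ , ui′) → trans (sym ui) ui′)
                                         (λ (uv , ui) (u′v , u′i) → parent-unique uv u′v (trans ui (sym u′i))))

  all-parents⇒n≤1+k : ∀ {v} → (∀ i → HasParent v i) → n ≤ suc k
  all-parents⇒n≤1+k {v} parent-of = begin
    n                                               ≡⟨ count-complement (_≟ᶠ v) ⟨
    count (_≟ᶠ v) + count (λ w → ¬? (w ≟ᶠ v))        ≡⟨ cong₂ _+_ (count-≡ v) (count-cong (λ {w} w≢v → c v w , w≢v , refl) (proj₁ ∘ proj₂) _ _) ⟩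
    1 + count (λ w → any? (R? w))                   ≤⟨ +-monoʳ-≤ 1 (count-domain≤ R? injective) ⟩
    suc k                                           ∎
    where
    open ≤-Reasoning
    R? : ∀ w i → Dec (w ≢ v × c v w ≡ i)
    R? w i = ¬? (w ≟ᶠ v) ×-dec (c v w ≟ᶠ i)
    injective : ∀ {w w′ i} → w ≢ v × c v w ≡ i → w′ ≢ v × c v w′ ≡ i → w ≡ w′
    injective {i = i} (w≢v , vw) (w′≢v , vw′) with parent-of i
    ... | u , uv , ui = trans (sole-edge-to-parent uv w≢v (trans vw (sym ui)))
                              (sym (sole-edge-to-parent uv w′≢v (trans vw′ (sym ui))))

  roots-positive : 2 + k ≤ n → ∀ v → 1 ≤ roots v
  roots-positive 2+k≤n v with any? (λ i → ¬? (hasParent? v i))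
  ... | yes (i , orphan) = count-positive (λ i → ¬? (hasParent? v i)) orphan
  ... | no ∄orphan = contradiction (≤-trans 2+k≤n (all-parents⇒n≤1+k parent-of)) 1+n≰n
    where
    parent-of : ∀ i → HasParent v i
    parent-of i = decidable-stable (hasParent? v i) λ orphan → ∄orphan (i , orphan)

  sole-root : ∀ {v i j} → roots v ≡ 1 → ¬ HasParent v i → ¬ HasParent v j → i ≡ j
  sole-root {v} {i} {j} one ¬pi ¬pj =
    decidable-stable (i ≟ᶠ j) λ i≢j →
      contradiction (≤-trans (count-pair (λ i → ¬? (hasParent? v i)) i≢j ¬pi ¬pj) (≤-reflexive one)) 1+n≰n

  -- The colour of uv is not i (else u would be a parent of v of colour i), so u, whose only root colour is i,
  -- has a parent w of that colour; uv being an edge of the same colour at u forces w = v, against u → v.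
  sole-roots-differ : ∀ {u v i} → Parent u v → roots u ≡ 1 → ¬ HasParent u i → ¬ HasParent v i → ⊥
  sole-roots-differ {u} {v} {i} uv one ¬pu ¬pv with c u v ≟ᶠ i
  ... | yes uv≡i = ¬pv (u , uv , uv≡i)
  ... | no uv≢i with decidable-stable (hasParent? u (c u v)) (uv≢i ∘ sym ∘ sole-root one ¬pu)
  ...   | w , wu , wu≡uv = parent-asym uv (subst (λ x → Parent x u) (sym v≡w) wu)
    where
    v≡w : v ≡ w
    v≡w = sole-edge-to-parent wu (proj₁ uv ∘ sym) (sym wu≡uv)

  #sole-roots≤k : count (λ v → roots v ≟ 1) ≤ k
  #sole-roots≤k = begin
    count (λ v → roots v ≟ 1)        ≡⟨ count-cong sole-root-colour (proj₁ ∘ proj₂) (λ v → roots v ≟ 1) (λ v → any? (R? v)) ⟩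
    count (λ v → any? (R? v))        ≤⟨ count-domain≤ R? injective ⟩
    k                                ∎
    where
    open ≤-Reasoning
    R? : ∀ v i → Dec (roots v ≡ 1 × ¬ HasParent v i)
    R? v i = (roots v ≟ 1) ×-dec ¬? (hasParent? v i)
    sole-root-colour : ∀ {v} → roots v ≡ 1 → ∃[ i ] (roots v ≡ 1 × ¬ HasParent v i)
    sole-root-colour {v} one with any? (λ i → ¬? (hasParent? v i))
    ... | yes (i , orphan) = i , one , orphan
    ... | no ∄orphan = contradiction (trans (sym one) (count-none _ λ i orphan → ∄orphan (i , orphan))) λ ()
    injective : ∀ {v v′ i} → roots v ≡ 1 × ¬ HasParent v i → roots v′ ≡ 1 × ¬ HasParent v′ i → v ≡ v′
    injective {v} {v′} (one , ¬p) (one′ , ¬p′) =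
      decidable-stable (v ≟ᶠ v′) λ v≢v′ → [ (λ vv′ → sole-roots-differ vv′ one ¬p ¬p′)
                                          , (λ v′v → sole-roots-differ v′v one′ ¬p′ ¬p) ]′ (parent-total v≢v′)

  counting-bound : 2 + k ≤ n → n * (n + 3) ≤ (n + 1) * (2 * k)
  counting-bound 2+k≤n = counting-arithmetic parents+roots tournament two-roots #sole-roots≤k
    where
    P R U : ℕ
    P = ∑[ v < n ] parents v
    R = ∑[ v < n ] roots v
    U = count (λ v → roots v ≟ 1)
    tournament : 2 * P + n ≡ n * n
    tournament = tournament-arcs parent? (λ uu → proj₁ uu refl) parent-asym parent-total
    parents+roots : P + R ≡ n * k
    parents+roots = trans (sym (∑-distrib-+ parents roots)) (trans (sum-cong-≗ parents+roots≡k) (∑-const n k))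
    two-roots : 2 * n ≤ R + U
    two-roots = begin
      2 * n                                           ≡⟨ trans (∑-const n 2) (*-comm n 2) ⟨
      ∑[ v < n ] 2                                    ≤⟨ ∑-mono-≤ (λ v → 2≤m+[m≡1] (roots-positive 2+k≤n v) (roots v ≟ 1)) ⟩
      ∑[ v < n ] (roots v + indicator (roots v ≟ 1))  ≡⟨ ∑-distrib-+ roots (λ v → indicator (roots v ≟ 1)) ⟩
      R + U                                           ∎
      where open ≤-Reasoning

half : ∀ {n} → Fin n → Fin ⌈ n /2⌉
half {suc n}       zero          = zero
half {suc (suc n)} (suc zero)    = zero
half {suc (suc n)} (suc (suc x)) = suc (half x)

side : ∀ {n} → Fin n → Bool
side zero          = false
side (suc zero)    = true
side (suc (suc x)) = side x

half-side-injective : ∀ {n} {x y : Fin n} → half x ≡ half y → side x ≡ side y → x ≡ y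
half-side-injective {x = zero}          {zero}          _  _  = refl
half-side-injective {x = zero}          {suc zero}      _  ()
half-side-injective {x = suc zero}      {zero}          _  ()
half-side-injective {x = suc zero}      {suc zero}      _  _  = refl
half-side-injective {x = suc (suc x)}   {suc (suc y)}   hh ss =
  cong (λ z → suc (suc z)) (half-side-injective (Finₚ.suc-injective hh) ss)
half-side-injective {x = zero}          {suc (suc y)}   () _
half-side-injective {x = suc zero}      {suc (suc y)}   () _
half-side-injective {x = suc (suc x)}   {zero}          () _
half-side-injective {x = suc (suc x)}   {suc zero}      () _

evenVertex : ∀ {n} → Fin ⌈ n /2⌉ → Fin n
evenVertex {suc n}       zero    = zero
evenVertex {suc (suc n)} (suc t) = suc (suc (evenVertex t))

half-evenVertex : ∀ {n} (t : Fin ⌈ n /2⌉) → half {n} (evenVertex t) ≡ t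
half-evenVertex {suc n}       zero    = refl
half-evenVertex {suc (suc n)} (suc t) = cong suc (half-evenVertex t)

side-evenVertex : ∀ {n} (t : Fin ⌈ n /2⌉) → side {n} (evenVertex t) ≡ false
side-evenVertex {suc n}       zero    = refl
side-evenVertex {suc (suc n)} (suc t) = side-evenVertex t

-- leafSide x h is the side on which the star centred at x has its leaves of level h.
leafSide : ∀ {n} → Fin n → Fin ⌈ n /2⌉ → Bool
leafSide x h with half x <ᶠ? h
... | yes _ = side x
... | no _  = not (side x)

IsCentreOf : ∀ {n} → Fin n → Fin n → Set
IsCentreOf x y = side y ≡ leafSide x (half y)

module _ {n : ℕ} where

  leafSide-< : ∀ {x : Fin n} {h} → half x <ᶠ h → leafSide x h ≡ side x
  leafSide-< {x} {h} x<h with half x <ᶠ? h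
  ... | yes _  = refl
  ... | no x≮h = contradiction x<h x≮h

  leafSide-≮ : ∀ {x : Fin n} {h} → ¬ half x <ᶠ h → leafSide x h ≡ not (side x)
  leafSide-≮ {x} {h} x≮h with half x <ᶠ? h
  ... | yes x<h = contradiction x<h x≮h
  ... | no _    = refl

  leafSide-injective : ∀ {y z : Fin n} {h} → half y ≡ half z → leafSide y h ≡ leafSide z h → side y ≡ side z
  leafSide-injective {y} {z} {h} hy≡hz same with half y <ᶠ? h | half z <ᶠ? h
  ... | yes _    | yes _    = same
  ... | no _     | no _     = not-injective same
  ... | yes y<h  | no z≮h   = contradiction (subst (_<ᶠ h) hy≡hz y<h) z≮h
  ... | no y≮h   | yes z<h  = contradiction (subst (_<ᶠ h) (sym hy≡hz) z<h) y≮h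

  centre-exclusive : ∀ {x y : Fin n} → half x ≢ half y → IsCentreOf x y → ¬ IsCentreOf y x
  centre-exclusive {x} {y} x≢y xy yx with Finₚ.<-cmp (half x) (half y)
  ... | tri< x<y _ y≮x = not-¬ (sym (trans xy (leafSide-< x<y))) (trans yx (leafSide-≮ y≮x))
  ... | tri≈ _ x≡y _   = x≢y x≡y
  ... | tri> x≮y _ y<x = not-¬ (sym (trans yx (leafSide-< y<x))) (trans xy (leafSide-≮ x≮y))

  centre-exhaustive : ∀ {x y : Fin n} → half x ≢ half y → ¬ IsCentreOf x y → IsCentreOf y x
  centre-exhaustive {x} {y} x≢y ¬xy with Finₚ.<-cmp (half x) (half y)
  ... | tri< x<y _ y≮x = trans (¬-not λ sx≡sy → ¬xy (trans (sym sx≡sy) (sym (leafSide-< x<y))))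
                               (sym (leafSide-≮ y≮x))
  ... | tri≈ _ x≡y _   = contradiction x≡y x≢y
  ... | tri> x≮y _ y<x = trans (decidable-stable (side x ≟ᵇ side y)
                                  λ sx≢sy → ¬xy (trans (¬-not (sx≢sy ∘ sym)) (sym (leafSide-≮ x≮y))))
                               (sym (leafSide-< y<x))

  isCentreOf? : ∀ (x y : Fin n) → Dec (IsCentreOf x y)
  isCentreOf? x y = side y ≟ᵇ leafSide x (half y)

  -- Colour zero is the matching within each level, colour suc t the stars centred at level t.
  starColour : Fin n → Fin n → Fin (suc ⌈ n /2⌉)
  starColour x y with half x ≟ᶠ half y | isCentreOf? x y
  ... | yes _ | _     = zero
  ... | no _  | yes _ = suc (half x)
  ... | no _  | no _  = suc (half y)

  starColour-symmetric : ∀ x y → starColour x y ≡ starColour y x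
  starColour-symmetric x y with half x ≟ᶠ half y | isCentreOf? x y | half y ≟ᶠ half x | isCentreOf? y x
  ... | yes _   | _      | yes _ | _      = refl
  ... | yes x≡y | _      | no y≢x | _     = contradiction (sym x≡y) y≢x
  ... | no x≢y  | _      | yes y≡x | _    = contradiction (sym y≡x) x≢y
  ... | no x≢y  | yes xy | no _  | yes yx = contradiction yx (centre-exclusive x≢y xy)
  ... | no _    | yes _  | no _  | no _   = refl
  ... | no _    | no _   | no _  | yes _  = refl
  ... | no x≢y  | no ¬xy | no _  | no ¬yx = contradiction (centre-exhaustive x≢y ¬xy) ¬yx

  starColour≡zero⇒ : ∀ {x y} → starColour x y ≡ zero → half x ≡ half y
  starColour≡zero⇒ {x} {y} eq with half x ≟ᶠ half y | isCentreOf? x y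
  ... | yes x≡y | _ = x≡y
  ... | no _ | yes _ = contradiction eq λ ()
  ... | no _ | no _  = contradiction eq λ ()

  starColour≡suc⇒ : ∀ {x y t} → starColour x y ≡ suc t →
                half x ≢ half y × (half x ≡ t × IsCentreOf x y ⊎ half y ≡ t × IsCentreOf y x)
  starColour≡suc⇒ {x} {y} eq with half x ≟ᶠ half y | isCentreOf? x y
  ... | yes _   | _      = contradiction eq λ ()
  ... | no x≢y  | yes xy = x≢y , inj₁ (Finₚ.suc-injective eq , xy)
  ... | no x≢y  | no ¬xy = x≢y , inj₂ (Finₚ.suc-injective eq , centre-exhaustive x≢y ¬xy)

  starColour-centre : ∀ {x y} → half x ≢ half y → IsCentreOf x y → starColour x y ≡ suc (half x)
  starColour-centre {x} {y} x≢y xy with half x ≟ᶠ half y | isCentreOf? x y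
  ... | yes x≡y | _     = contradiction x≡y x≢y
  ... | no _    | yes _ = refl
  ... | no _    | no ¬xy = contradiction xy ¬xy

  matching-starForest : StarForest (ColourClass starColour zero)
  matching-starForest = record
    { isCentre              = side
    ; proper                = λ (x≢y , xy) → sides-differ x≢y xy
    ; leaf-neighbour-unique = λ _ (x≢y , xy) (x≢z , xz) →
        half-side-injective (trans (sym (starColour≡zero⇒ xy)) (starColour≡zero⇒ xz))
                            (trans (¬-not (sides-differ x≢y xy ∘ sym)) (sym (¬-not (sides-differ x≢z xz ∘ sym))))
    }
    where
    sides-differ : ∀ {x y} → x ≢ y → starColour x y ≡ zero → side x ≢ side y
    sides-differ x≢y xy sx≡sy = x≢y (half-side-injective (starColour≡zero⇒ xy) sx≡sy)

  star-starForest : ∀ t → StarForest (ColourClass starColour (suc t))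
  star-starForest t = record
    { isCentre              = isCentre
    ; proper                = λ (_ , xy) → proper (starColour≡suc⇒ xy)
    ; leaf-neighbour-unique = λ leaf-x (_ , xy) (_ , xz) → centre-unique (centre-of leaf-x xy) (centre-of leaf-x xz)
    }
    where
    isCentre : Fin n → Bool
    isCentre x = does (half x ≟ᶠ t)

    centre-level : ∀ {x y} → isCentre x ≡ isCentre y → half x ≡ t → half y ≡ t
    centre-level {x} {y} same x≡t = decidable-stable (half y ≟ᶠ t) λ y≢t →
      contradiction (trans (sym (dec-true (half x ≟ᶠ t) x≡t)) (trans same (dec-false (half y ≟ᶠ t) y≢t))) λ ()

    proper : ∀ {x y} → half x ≢ half y × (half x ≡ t × IsCentreOf x y ⊎ half y ≡ t × IsCentreOf y x) →
             isCentre x ≢ isCentre y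
    proper (x≢y , inj₁ (x≡t , _)) same = x≢y (trans x≡t (sym (centre-level same x≡t)))
    proper (x≢y , inj₂ (y≡t , _)) same = x≢y (trans (centre-level (sym same) y≡t) (sym y≡t))

    centre-of : ∀ {x w} → isCentre x ≡ false → starColour x w ≡ suc t → half w ≡ t × IsCentreOf w x
    centre-of {x} leaf-x xw with starColour≡suc⇒ xw
    ... | _ , inj₁ (x≡t , _) = contradiction (trans (sym (dec-true (half x ≟ᶠ t) x≡t)) leaf-x) λ ()
    ... | _ , inj₂ centred   = centred

    centre-unique : ∀ {x y z} → half y ≡ t × IsCentreOf y x → half z ≡ t × IsCentreOf z x → y ≡ z
    centre-unique {x} {y} {z} (y≡t , yx) (z≡t , zx) =
      half-side-injective y≡z (leafSide-injective {h = half x} y≡z (trans (sym yx) zx))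
      where
      y≡z : half y ≡ half z
      y≡z = trans y≡t (sym z≡t)

starColour-classes-nonempty : ∀ {m} (i : Fin (suc ⌈ 3 + m /2⌉)) → ∃[ x ] ∃[ y ] (x ≢ y × starColour {3 + m} x y ≡ i)
starColour-classes-nonempty zero          = zero , suc zero , (λ ()) , refl
starColour-classes-nonempty (suc zero)    = zero , suc (suc zero) , (λ ()) , refl
starColour-classes-nonempty (suc (suc t)) = evenVertex (suc t) , suc zero , halves-differ ∘ cong half , coloured
  where
  halves-differ : half (evenVertex (suc t)) ≢ zero
  halves-differ e = Finₚ.0≢1+n (trans (sym e) (half-evenVertex (suc t)))
  centred : IsCentreOf (evenVertex (suc t)) (suc zero)
  centred = sym (trans (leafSide-≮ {x = evenVertex (suc t)} {h = zero} λ ()) (cong not (side-evenVertex (suc t))))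
  coloured : starColour (evenVertex (suc t)) (suc zero) ≡ suc (suc t)
  coloured = trans (starColour-centre halves-differ centred) (cong suc (half-evenVertex (suc t)))

upper-bound : ∀ {n} → 3 ≤ n → P4C4AvoidingBipartitePartition n (suc ⌈ n /2⌉)
upper-bound (s≤s (s≤s (s≤s _))) = record
  { colour    = starColour
  ; symmetric = starColour-symmetric
  ; nonempty  = starColour-classes-nonempty
  ; bipartite = λ i → starForest⇒bipartite (starForest i)
  ; P4-free   = λ i → starForest⇒¬P4 (starForest i) (colourClass-symmetric starColour-symmetric i) ∘ inducedP4⇒P4
  ; C4-free   = λ i → starForest⇒¬P4 (starForest i) (colourClass-symmetric starColour-symmetric i) ∘ inducedC4⇒P4
  }
  where
  starForest : ∀ i → StarForest (ColourClass starColour i)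
  starForest zero    = matching-starForest
  starForest (suc t) = star-starForest t

2+⌈n/2⌉≤n : ∀ {n} → 4 ≤ n → 2 + ⌈ n /2⌉ ≤ n
2+⌈n/2⌉≤n (s≤s (s≤s (s≤s (s≤s {n = m} _)))) = s≤s (s≤s (s≤s (s≤s (⌈n/2⌉≤n m))))

2*⌈n/2⌉≤n+1 : ∀ n → 2 * ⌈ n /2⌉ ≤ n + 1
2*⌈n/2⌉≤n+1 n = begin
  2 * ⌈ n /2⌉                      ≡⟨ cong (⌈ n /2⌉ +_) (+-identityʳ ⌈ n /2⌉) ⟩
  ⌈ n /2⌉ + ⌈ n /2⌉                ≤⟨ +-monoʳ-≤ ⌈ n /2⌉ (⌊n/2⌋≤⌈n/2⌉ (suc n)) ⟩
  ⌊ suc n /2⌋ + ⌈ suc n /2⌉        ≡⟨ ⌊n/2⌋+⌈n/2⌉≡n (suc n) ⟩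
  suc n                            ≡⟨ +-comm 1 n ⟩
  n + 1                            ∎
  where open ≤-Reasoning

[n+1]²<n[n+3] : ∀ {n} → 2 ≤ n → (n + 1) * (n + 1) < n * (n + 3)
[n+1]²<n[n+3] (s≤s (s≤s {n = m} _)) = ≤-trans (m≤m+n _ m) (≤-reflexive (solve (m ∷ [])))

lower-bound : ∀ {n} → 4 ≤ n → ∀ k → P4C4AvoidingBipartitePartition n k → suc ⌈ n /2⌉ ≤ k
lower-bound {n} 4≤n k P = ≮⇒≥ λ k<1+⌈n/2⌉ → <-irrefl refl (too-few k<1+⌈n/2⌉)
  where
  open Orientation (partition⇒starForestColouring P)
  too-few : k < suc ⌈ n /2⌉ → n * (n + 3) < n * (n + 3)
  too-few k<1+⌈n/2⌉ = begin-strict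
    n * (n + 3)                  ≤⟨ counting-bound (≤-trans (+-monoʳ-≤ 2 k≤⌈n/2⌉) (2+⌈n/2⌉≤n 4≤n)) ⟩
    (n + 1) * (2 * k)            ≤⟨ *-monoʳ-≤ (n + 1) (≤-trans (*-monoʳ-≤ 2 k≤⌈n/2⌉) (2*⌈n/2⌉≤n+1 n)) ⟩
    (n + 1) * (n + 1)            <⟨ [n+1]²<n[n+3] (≤-trans (s≤s (s≤s z≤n)) 4≤n) ⟩
    n * (n + 3)                  ∎
    where
    open ≤-Reasoning
    k≤⌈n/2⌉ : k ≤ ⌈ n /2⌉
    k≤⌈n/2⌉ = m<1+n⇒m≤n k<1+⌈n/2⌉

mainTheorem5 : ∀ (n : ℕ) → 4 ≤ n → ChiP4C4Is n (⌈ n /2⌉ + 1)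
mainTheorem5 n 4≤n = subst (ChiP4C4Is n) (+-comm 1 ⌈ n /2⌉) (upper-bound (≤-trans (n≤1+n 3) 4≤n) , lower-bound 4≤n)
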